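{- Let $T_1,T_2$ be two trees on the same label set $\mathcal{X}$ and let $d,d'$ be integers with $d'\le d$ and $d<d_{LR}(T_1,T_2)\le d'+d$. Suppose there are a tree $T^*$ on label set $\mathcal{X}$ and subsets $X_1,X_2\subseteq\mathcal{X}$ such that $T_1-X_1=T^*-X_1$, $T_2-X_2=T^*-X_2$, $|X_1|\le d'$ and $|X_2|\le d$. Then there is a minimal disagreement $X$ between $T_1$ and $T_2$ with $|X|\le d+d'$, and some $x\in X$ with $x\in X_1\setminus X_2$.
   Context: All trees are rooted binary phylogenetic trees: rooted trees in which every non-leaf node has exactly two children, whose leaves are bijectively labeled by a finite label set $\mathcal{X}(T)$; two trees are equal if there is a label-preserving isomorphism between them. For $L\subseteq\mathcal{X}(T)$, $T-L$ is the tree obtained from $T$ by removing every leaf labeled by an element of $L$, contracting the resulting non-root vertices of degree two, and repeatedly deleting the root while it has degree one. For two trees $T_1,T_2$ on the same label set $\mathcal{X}$, $d_{LR}(T_1,T_2)=\min\{|X| : X\subseteq\mathcal{X},\ T_1-X=T_2-X\}$. A set $X\subseteq\mathcal{X}$ is a minimal disagreement between $T_1$ and $T_2$ if $T_1-X=T_2-X$ and $T_1-X'\neq T_2-X'$ for every proper subset $X'\subsetneq X$. -}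

module Defs where

open import Data.Nat using (ℕ; _≤_; _<_; _+_; _≟_)
open import Data.List using (List; []; _∷_; _++_; length)
open import Data.List.Relation.Unary.Unique.Propositional using (Unique)
open import Data.List.Membership.Propositional using (_∈_; _∉_)
open import Data.List.Membership.DecPropositional _≟_ using (_∈?_)
open import Data.Maybe using (Maybe; just; nothing)
open import Data.Product using (_×_; Σ; ∃; ∃-syntax; _,_)
open import Data.Sum using (_⊎_)
open import Relation.Nullary using (¬_; yes; no)
open import Function.Bundles using (_⇔_)
open import Relation.Binary.PropositionalEquality using (_≡_)

data Tree : Set where
  leaf : ℕ → Tree
  node : Tree → Tree → Tree

leaves : Tree → List ℕ
leaves (leaf x)   = x ∷ []
leaves (node l r) = leaves l ++ leaves r

-- Rooted binary phylogenetic tree: leaves bijectively labelled (distinct labels).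
Phylo : Tree → Set
Phylo T = Unique (leaves T)

-- Equality of trees: label-preserving isomorphism (children are unordered).
data _≅_ : Tree → Tree → Set where
  leaf≅ : ∀ x → leaf x ≅ leaf x
  node≅ : ∀ {a b c d} → a ≅ c → b ≅ d → node a b ≅ node c d
  swap≅ : ∀ {a b c d} → a ≅ d → b ≅ c → node a b ≅ node c d

data _≅ₘ_ : Maybe Tree → Maybe Tree → Set where
  nothing≅ : nothing ≅ₘ nothing
  just≅    : ∀ {S T} → S ≅ T → just S ≅ₘ just T

-- T - L : delete leaves labelled in L, suppress degree-two vertices,
-- and delete a degree-one root repeatedly (nothing = empty tree).
_-_ : Tree → List ℕ → Maybe Tree
leaf x - L with x ∈? L
... | yes _ = nothing
... | no  _ = just (leaf x)
node l r - L with l - L | r - L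
... | just l' | just r' = just (node l' r')
... | just l' | nothing = just l'
... | nothing | just r' = just r'
... | nothing | nothing = nothing

SameLabels : Tree → Tree → Set
SameLabels T U = ∀ x → (x ∈ leaves T) ⇔ (x ∈ leaves U)

-- X is a subset of the label set of T, given as a duplicate-free list
-- (so that |X| = length X).
SubsetOf : List ℕ → Tree → Set
SubsetOf X T = Unique X × (∀ {x} → x ∈ X → x ∈ leaves T)

Agree : Tree → Tree → List ℕ → Set
Agree T₁ T₂ X = (T₁ - X) ≅ₘ (T₂ - X)

DLR : Tree → Tree → ℕ → Set
DLR T₁ T₂ k =
  (Σ (List ℕ) λ X → SubsetOf X T₁ × Agree T₁ T₂ X × length X ≡ k)
  × (∀ X → SubsetOf X T₁ → Agree T₁ T₂ X → k ≤ length X)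

_⊊_ : List ℕ → List ℕ → Set
X' ⊊ X = (∀ {x} → x ∈ X' → x ∈ X) × (∃[ y ] (y ∈ X × y ∉ X'))

MinDisagreement : Tree → Tree → List ℕ → Set
MinDisagreement T₁ T₂ X = Agree T₁ T₂ X × (∀ X' → X' ⊊ X → ¬ Agree T₁ T₂ X')

-- Put Z = X₁ ∪ X₂.  Deleting more labels preserves agreement, so
-- T₁ - Z = T* - Z = T₂ - Z and Z is a disagreement set of size at most d' + d.
-- Shrinking Z one label at a time yields a minimal disagreement X ⊆ Z, so
-- |X| ≤ d + d'.  If X were contained in X₂ we would get
-- k = d_LR(T₁,T₂) ≤ |X| ≤ |X₂| ≤ d < k; hence some x ∈ X lies outside X₂,
-- and therefore in X₁.
module Submission where

open import Defs
open import Data.Nat using (ℕ; _≤_; _<_; _+_; suc; _≟_; z≤n; s≤s)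
open import Data.Nat.Properties using (≤-trans; <-≤-trans; ≤-refl; <-irrefl; +-comm; +-mono-≤; ≤-reflexive)
open import Data.List using (List; []; _∷_; _++_; length; filter)
open import Data.List.Properties using (length-++; length-filter; filter-notAll)
open import Data.List.Membership.Propositional using (_∈_; _∉_; find; lose)
open import Data.List.Membership.Propositional.Properties using (∈-filter⁺; ∈-filter⁻; ∈-++⁺ˡ; ∈-++⁺ʳ; ∈-++⁻)
open import Data.List.Membership.DecPropositional _≟_ using (_∈?_)
open import Data.List.Relation.Binary.Subset.Propositional using (_⊆_)
open import Data.List.Relation.Unary.Any using (here; there; any?)
open import Data.List.Relation.Unary.AllPairs using (_∷_)
import Data.List.Relation.Unary.All as All
open import Data.List.Relation.Unary.Unique.Propositional using (Unique)
import Data.List.Relation.Unary.Unique.Propositional.Properties as Unique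
open import Data.Maybe using (Maybe; just; nothing; _>>=_)
open import Data.Product using (_×_; Σ; ∃; ∃-syntax; _,_; proj₁; proj₂)
open import Data.Sum using (_⊎_; inj₁; inj₂)
open import Data.Empty using (⊥-elim)
open import Relation.Nullary using (¬_; Dec; yes; no; ¬?; map′; _×-dec_; _⊎-dec_)
open import Relation.Binary.PropositionalEquality using (_≡_; _≢_; refl; sym; cong₂; subst₂; module ≡-Reasoning)

≅-refl : ∀ T → T ≅ T
≅-refl (leaf x)   = leaf≅ x
≅-refl (node l r) = node≅ (≅-refl l) (≅-refl r)

≅-sym : ∀ {S T} → S ≅ T → T ≅ S
≅-sym (leaf≅ x)   = leaf≅ x
≅-sym (node≅ p q) = node≅ (≅-sym p) (≅-sym q)
≅-sym (swap≅ p q) = swap≅ (≅-sym q) (≅-sym p)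

≅-trans : ∀ {S T U} → S ≅ T → T ≅ U → S ≅ U
≅-trans (leaf≅ x)   q             = q
≅-trans (node≅ p q) (node≅ p' q') = node≅ (≅-trans p p') (≅-trans q q')
≅-trans (node≅ p q) (swap≅ p' q') = swap≅ (≅-trans p p') (≅-trans q q')
≅-trans (swap≅ p q) (node≅ p' q') = swap≅ (≅-trans p q') (≅-trans q p')
≅-trans (swap≅ p q) (swap≅ p' q') = node≅ (≅-trans p q') (≅-trans q p')

-- Two cherries are isomorphic iff their children match straight or crossed.
-- Decidability is what lets us test, label by label, whether a label can be
-- dropped from a disagreement set.
_≅?_ : ∀ S T → Dec (S ≅ T)
leaf x ≅? leaf y with x ≟ y
... | yes refl = yes (leaf≅ x)
... | no x≢y   = no λ { (leaf≅ _) → x≢y refl }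
leaf _ ≅? node _ _ = no λ ()
node _ _ ≅? leaf _ = no λ ()
node a b ≅? node c d =
  map′ fromCases toCases ((a ≅? c ×-dec b ≅? d) ⊎-dec (a ≅? d ×-dec b ≅? c))
  where
  fromCases : (a ≅ c × b ≅ d) ⊎ (a ≅ d × b ≅ c) → node a b ≅ node c d
  fromCases (inj₁ (p , q)) = node≅ p q
  fromCases (inj₂ (p , q)) = swap≅ p q
  toCases : node a b ≅ node c d → (a ≅ c × b ≅ d) ⊎ (a ≅ d × b ≅ c)
  toCases (node≅ p q) = inj₁ (p , q)
  toCases (swap≅ p q) = inj₂ (p , q)

≅ₘ-refl : ∀ M → M ≅ₘ M
≅ₘ-refl nothing  = nothing≅
≅ₘ-refl (just T) = just≅ (≅-refl T)

≅ₘ-sym : ∀ {M N} → M ≅ₘ N → N ≅ₘ M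
≅ₘ-sym nothing≅  = nothing≅
≅ₘ-sym (just≅ p) = just≅ (≅-sym p)

≅ₘ-trans : ∀ {M N O} → M ≅ₘ N → N ≅ₘ O → M ≅ₘ O
≅ₘ-trans nothing≅  q         = q
≅ₘ-trans (just≅ p) (just≅ q) = just≅ (≅-trans p q)

_≅ₘ?_ : ∀ M N → Dec (M ≅ₘ N)
nothing ≅ₘ? nothing = yes nothing≅
nothing ≅ₘ? just _  = no λ ()
just _  ≅ₘ? nothing = no λ ()
just S  ≅ₘ? just T  = map′ just≅ (λ { (just≅ p) → p }) (S ≅? T)

join : Maybe Tree → Maybe Tree → Maybe Tree
join (just l) (just r) = just (node l r)
join (just l) nothing  = just l
join nothing  (just r) = just r
join nothing  nothing  = nothing

restrict-node : ∀ l r L → (node l r - L) ≡ join (l - L) (r - L)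
restrict-node l r L with l - L | r - L
... | just _  | just _  = refl
... | just _  | nothing = refl
... | nothing | just _  = refl
... | nothing | nothing = refl

join-restrict : ∀ M N Y →
  (join M N >>= (_- Y)) ≡ join (M >>= (_- Y)) (N >>= (_- Y))
join-restrict (just l) (just r) Y = restrict-node l r Y
join-restrict (just l) nothing  Y with l - Y
... | just _  = refl
... | nothing = refl
join-restrict nothing  (just r) Y with r - Y
... | just _  = refl
... | nothing = refl
join-restrict nothing  nothing  Y = refl

restrict-twice : ∀ {X Y} → X ⊆ Y → ∀ T → (T - Y) ≡ ((T - X) >>= (_- Y))
restrict-twice {X} {Y} X⊆Y (leaf x) with x ∈? X
... | no _ = refl
... | yes x∈X with x ∈? Y
...   | yes _  = refl
...   | no x∉Y = ⊥-elim (x∉Y (X⊆Y x∈X))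
restrict-twice {X} {Y} X⊆Y (node l r) = begin
  node l r - Y                                ≡⟨ restrict-node l r Y ⟩
  join (l - Y) (r - Y)                        ≡⟨ cong₂ join (restrict-twice X⊆Y l) (restrict-twice X⊆Y r) ⟩
  join (l - X >>= (_- Y)) (r - X >>= (_- Y))  ≡⟨ sym (join-restrict (l - X) (r - X) Y) ⟩
  (join (l - X) (r - X) >>= (_- Y))           ≡⟨ cong₂ _>>=_ (sym (restrict-node l r X)) refl ⟩
  (node l r - X >>= (_- Y))                   ∎
  where open ≡-Reasoning

join-cong : ∀ {M N M' N'} → M ≅ₘ M' → N ≅ₘ N' → join M N ≅ₘ join M' N'
join-cong nothing≅  nothing≅  = nothing≅
join-cong nothing≅  (just≅ q) = just≅ q
join-cong (just≅ p) nothing≅  = just≅ p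
join-cong (just≅ p) (just≅ q) = just≅ (node≅ p q)

join-swap : ∀ {M N M' N'} → M ≅ₘ N' → N ≅ₘ M' → join M N ≅ₘ join M' N'
join-swap nothing≅  nothing≅  = nothing≅
join-swap nothing≅  (just≅ q) = just≅ q
join-swap (just≅ p) nothing≅  = just≅ p
join-swap (just≅ p) (just≅ q) = just≅ (swap≅ p q)

restrict-cong : ∀ {S U} Y → S ≅ U → (S - Y) ≅ₘ (U - Y)
restrict-cong Y (leaf≅ x) = ≅ₘ-refl (leaf x - Y)
restrict-cong Y (node≅ {a} {b} {c} {d} p q) =
  subst₂ _≅ₘ_ (sym (restrict-node a b Y)) (sym (restrict-node c d Y))
    (join-cong (restrict-cong Y p) (restrict-cong Y q))
restrict-cong Y (swap≅ {a} {b} {c} {d} p q) =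
  subst₂ _≅ₘ_ (sym (restrict-node a b Y)) (sym (restrict-node c d Y))
    (join-swap (restrict-cong Y p) (restrict-cong Y q))

restrict-congₘ : ∀ {M N} Y → M ≅ₘ N → (M >>= (_- Y)) ≅ₘ (N >>= (_- Y))
restrict-congₘ Y nothing≅  = nothing≅
restrict-congₘ Y (just≅ p) = restrict-cong Y p

agree-mono : ∀ {T U X Y} → X ⊆ Y → Agree T U X → Agree T U Y
agree-mono {T} {U} X⊆Y agreeX =
  subst₂ _≅ₘ_ (sym (restrict-twice X⊆Y T)) (sym (restrict-twice X⊆Y U))
    (restrict-congₘ _ agreeX)

remove : ℕ → List ℕ → List ℕ
remove z = filter (λ w → ¬? (w ≟ z))

∈-remove⁺ : ∀ {x z S} → x ∈ S → x ≢ z → x ∈ remove z S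
∈-remove⁺ {z = z} = ∈-filter⁺ (λ w → ¬? (w ≟ z))

remove-⊆ : ∀ z S → remove z S ⊆ S
remove-⊆ z S x∈ = proj₁ (∈-filter⁻ (λ w → ¬? (w ≟ z)) x∈)

remove-unique : ∀ z {S} → Unique S → Unique (remove z S)
remove-unique z = Unique.filter⁺ (λ w → ¬? (w ≟ z))

length-remove : ∀ {z S} → z ∈ S → length (remove z S) < length S
length-remove {z} {S} z∈S = filter-notAll (λ w → ¬? (w ≟ z)) S (lose z∈S (λ z≢z → z≢z refl))

unique-⊆-length : ∀ {xs ys} → Unique xs → xs ⊆ ys → length xs ≤ length ys
unique-⊆-length {[]}     _              _       = z≤n
unique-⊆-length {x ∷ xs} {ys} (x∉xs ∷ uxs) x∷xs⊆ys =
  <-≤-trans (s≤s (unique-⊆-length uxs xs⊆rest)) (length-remove (x∷xs⊆ys (here refl)))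
  where
  xs⊆rest : xs ⊆ remove x ys
  xs⊆rest w∈xs = ∈-remove⁺ (x∷xs⊆ys (there w∈xs)) (λ w≡x → All.lookup x∉xs w∈xs (sym w≡x))

escape-or-⊆ : ∀ X Y → (∃[ x ] (x ∈ X × x ∉ Y)) ⊎ X ⊆ Y
escape-or-⊆ X Y with any? (λ x → ¬? (x ∈? Y)) X
... | yes escapes = inj₁ (find escapes)
... | no ¬escapes = inj₂ inside
  where
  inside : X ⊆ Y
  inside {x} x∈X with x ∈? Y
  ... | yes x∈Y = x∈Y
  ... | no  x∉Y = ⊥-elim (¬escapes (lose x∈X x∉Y))

_∪_ : List ℕ → List ℕ → List ℕ
X₁ ∪ X₂ = X₁ ++ filter (λ x → ¬? (x ∈? X₁)) X₂

∪-unique : ∀ {X₁ X₂} → Unique X₁ → Unique X₂ → Unique (X₁ ∪ X₂)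
∪-unique {X₁} {X₂} u₁ u₂ =
  Unique.++⁺ u₁ (Unique.filter⁺ new? u₂)
    (λ (x∈X₁ , x∈new) → proj₂ (∈-filter⁻ new? {xs = X₂} x∈new) x∈X₁)
  where new? = λ x → ¬? (x ∈? X₁)

∪-⊆ˡ : ∀ X₁ X₂ → X₁ ⊆ X₁ ∪ X₂
∪-⊆ˡ _ _ = ∈-++⁺ˡ

∪-⊆ʳ : ∀ X₁ X₂ → X₂ ⊆ X₁ ∪ X₂
∪-⊆ʳ X₁ X₂ {x} x∈X₂ with x ∈? X₁
... | yes x∈X₁ = ∈-++⁺ˡ x∈X₁
... | no  x∉X₁ = ∈-++⁺ʳ X₁ (∈-filter⁺ (λ y → ¬? (y ∈? X₁)) x∈X₂ x∉X₁)

∪-cases : ∀ X₁ X₂ {x} → x ∈ X₁ ∪ X₂ → x ∈ X₁ ⊎ x ∈ X₂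
∪-cases X₁ X₂ x∈ with ∈-++⁻ X₁ x∈
... | inj₁ x∈X₁  = inj₁ x∈X₁
... | inj₂ x∈new = inj₂ (proj₁ (∈-filter⁻ (λ y → ¬? (y ∈? X₁)) {xs = X₂} x∈new))

length-∪ : ∀ X₁ X₂ → length (X₁ ∪ X₂) ≤ length X₁ + length X₂
length-∪ X₁ X₂ = ≤-trans (≤-reflexive (length-++ X₁))
  (+-mono-≤ {length X₁} (≤-reflexive refl) (length-filter (λ x → ¬? (x ∈? X₁)) X₂))

-- By upward closure, an agreement set is a minimal disagreement as soon as
-- no single label can be dropped from it.
minimal-if-no-single-drop : ∀ {T₁ T₂ S} → Agree T₁ T₂ S →
  (∀ {z} → z ∈ S → ¬ Agree T₁ T₂ (remove z S)) → MinDisagreement T₁ T₂ S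
minimal-if-no-single-drop {T₁} {T₂} {S} agreeS noDrop = agreeS , minimal
  where
  minimal : ∀ X' → X' ⊊ S → ¬ Agree T₁ T₂ X'
  minimal X' (X'⊆S , y , y∈S , y∉X') agreeX' = noDrop y∈S (agree-mono {T₁} {T₂} X'⊆rest agreeX')
    where
    X'⊆rest : X' ⊆ remove y S
    X'⊆rest x∈X' = ∈-remove⁺ (X'⊆S x∈X') (λ { refl → y∉X' x∈X' })

-- Every duplicate-free agreement set S contains a minimal disagreement: drop
-- labels one at a time while agreement survives (n bounds the number of steps).
minimal-disagreement-⊆ : ∀ T₁ T₂ n S → length S ≤ n → Unique S → Agree T₁ T₂ S →
  Σ (List ℕ) λ X → Unique X × X ⊆ S × MinDisagreement T₁ T₂ X
minimal-disagreement-⊆ T₁ T₂ n S |S|≤n uS agreeS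
  with any? (λ z → (T₁ - remove z S) ≅ₘ? (T₂ - remove z S)) S
... | no ¬drop = S , uS , (λ x∈S → x∈S) ,
  minimal-if-no-single-drop {T₁} {T₂} agreeS (λ z∈S agree → ¬drop (lose z∈S agree))
... | yes drop with find drop
...   | z , z∈S , agreeRest with n | <-≤-trans (length-remove z∈S) |S|≤n
...     | suc m | s≤s |rest|≤m with minimal-disagreement-⊆ T₁ T₂ m (remove z S) |rest|≤m
                                      (remove-unique z uS) agreeRest
...       | X , uX , X⊆rest , minX = X , uX , (λ x∈X → remove-⊆ z S (X⊆rest x∈X)) , minX

lemma6 : (T₁ T₂ T* : Tree) → Phylo T₁ → Phylo T₂ → Phylo T*
    → SameLabels T₁ T₂ → SameLabels T* T₁
    → (d d' k : ℕ) → d' ≤ d → DLR T₁ T₂ k → d < k → k ≤ d' + d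
    → (X₁ X₂ : List ℕ) → SubsetOf X₁ T₁ → SubsetOf X₂ T₁
    → Agree T₁ T* X₁ → Agree T₂ T* X₂
    → length X₁ ≤ d' → length X₂ ≤ d
    → Σ (List ℕ) λ X → SubsetOf X T₁ × MinDisagreement T₁ T₂ X × length X ≤ d + d'
        × ∃[ x ] (x ∈ X × x ∈ X₁ × x ∉ X₂)
lemma6 T₁ T₂ T* _ _ _ _ _ d d' k _ (_ , dLR-min) d<k _ X₁ X₂ (u₁ , X₁⊆T₁) (u₂ , X₂⊆T₁)
       agree₁ agree₂ |X₁|≤d' |X₂|≤d
  with minimal-disagreement-⊆ T₁ T₂ _ (X₁ ∪ X₂) ≤-refl (∪-unique u₁ u₂) agreeZ
  where
  -- T₁ - Z = T* - Z = T₂ - Z for Z = X₁ ∪ X₂.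
  agreeZ : Agree T₁ T₂ (X₁ ∪ X₂)
  agreeZ = ≅ₘ-trans (agree-mono {T₁} {T*} (∪-⊆ˡ X₁ X₂) agree₁)
                    (≅ₘ-sym (agree-mono {T₂} {T*} (∪-⊆ʳ X₁ X₂) agree₂))
... | X , uX , X⊆Z , minX = X , (uX , X⊆T₁) , minX , |X|≤d+d' , witness
  where
  X⊆T₁ : X ⊆ leaves T₁
  X⊆T₁ x∈X with ∪-cases X₁ X₂ (X⊆Z x∈X)
  ... | inj₁ x∈X₁ = X₁⊆T₁ x∈X₁
  ... | inj₂ x∈X₂ = X₂⊆T₁ x∈X₂
  |X|≤d+d' : length X ≤ d + d'
  |X|≤d+d' = ≤-trans (unique-⊆-length uX X⊆Z)
    (≤-trans (length-∪ X₁ X₂) (≤-trans (+-mono-≤ |X₁|≤d' |X₂|≤d) (≤-reflexive (+-comm d' d))))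
  -- X ⊆ X₂ would give k ≤ |X| ≤ |X₂| ≤ d < k.
  witness : ∃[ x ] (x ∈ X × x ∈ X₁ × x ∉ X₂)
  witness with escape-or-⊆ X X₂
  ... | inj₂ X⊆X₂ = ⊥-elim (<-irrefl refl (<-≤-trans d<k
          (≤-trans (dLR-min X (uX , X⊆T₁) (proj₁ minX)) (≤-trans (unique-⊆-length uX X⊆X₂) |X₂|≤d))))
  ... | inj₁ (x , x∈X , x∉X₂) with ∪-cases X₁ X₂ (X⊆Z x∈X)
  ...   | inj₁ x∈X₁ = x , x∈X , x∈X₁ , x∉X₂
  ...   | inj₂ x∈X₂ = ⊥-elim (x∉X₂ x∈X₂)
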